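{- Let $\mathscr{D}$ be the class of finite rational diversities. Then the class $\mathscr{D}_p$ of $\mathscr{D}$-systems has the joint embedding property. Hence $\mathrm{Aut}(\mathbb{U}_{\mathbb{Q}})$ has a dense conjugacy class.
   Context: A diversity is a set $X$ with a map $\delta$ from finite subsets to $\mathbb{R}$ such that (D1) $\delta(A)\ge0$ with $\delta(A)=0$ iff $|A|\le1$, and (D2) $\delta(A\cup B)+\delta(B\cup C)\ge\delta(A\cup C)$ whenever $B\ne\emptyset$; it is rational if $\delta$ is rational-valued. $\mathbb{U}_{\mathbb{Q}}$, the rational Urysohn diversity, is the Fraïssé limit of $\mathscr{D}$ (the unique countable ultrahomogeneous rational diversity whose finite subdiversities are, up to isomorphism, exactly the members of $\mathscr{D}$). A $\mathscr{D}$-system $(A,(f,A_0))$ consists of $A\in\mathscr{D}$, a subdiversity $A_0\subset A$ and a partial automorphism (diversity-preserving injection) $f\colon A_0\to A$. An embedding of $(A,(f,A_0))$ into $(B,(g,B_0))$ is a diversity embedding $\Phi\colon A\to B$ mapping $A_0$ into $B_0$ and $f(A_0)$ into $g(B_0)$ with $\Phi\circ f\subset g\circ\Phi$. The joint embedding property means any two systems embed into a common system. $\mathrm{Aut}(\mathbb{U}_{\mathbb{Q}})$ carries the pointwise convergence topology; a dense conjugacy class means some element has dense orbit under conjugation $g\cdot h=ghg^{ -1}$. -}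

module Defs where

open import Level using (Level; 0ℓ)
open import Data.Nat using (ℕ)
open import Data.Fin using (Fin)
open import Data.Maybe using (Maybe; just)
open import Data.List using (List; []; _∷_; _++_; map)
open import Data.List.Membership.Propositional using (_∈_)
open import Data.Rational using (ℚ; 0ℚ; _+_; _≤_)
open import Data.Product using (Σ; ∃; _×_; _,_)
open import Relation.Binary.PropositionalEquality using (_≡_)
open import Relation.Nullary using (¬_)
open import Function using (_∘_)

-- Finite subsets of X are represented by lists; δ must not depend on
-- order/multiplicity (axiom `respects`).

_⊆ˡ_ : {X : Set} → List X → List X → Set
A ⊆ˡ B = ∀ {x} → x ∈ A → x ∈ B

AtMostOne : {X : Set} → List X → Set
AtMostOne A = ∀ {x y} → x ∈ A → y ∈ A → x ≡ y

NonEmpty : {X : Set} → List X → Set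
NonEmpty B = ∃ λ x → x ∈ B

record IsRationalDiversity {X : Set} (δ : List X → ℚ) : Set where
  field
    respects : ∀ A B → A ⊆ˡ B → B ⊆ˡ A → δ A ≡ δ B
    nonneg   : ∀ A → 0ℚ ≤ δ A
    zero⇒≤1  : ∀ A → δ A ≡ 0ℚ → AtMostOne A
    ≤1⇒zero  : ∀ A → AtMostOne A → δ A ≡ 0ℚ
    triangle : ∀ A B C → NonEmpty B → δ (A ++ C) ≤ δ (A ++ B) + δ (B ++ C)

record FinDiv : Set where
  field
    size  : ℕ
    δ     : List (Fin size) → ℚ
    isDiv : IsRationalDiversity δ

open FinDiv public

Injective : {X Y : Set} → (X → Y) → Set
Injective f = ∀ {x y} → f x ≡ f y → x ≡ y

IsDivEmbedding : (A B : FinDiv) → (Fin (size A) → Fin (size B)) → Set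
IsDivEmbedding A B Φ =
  Injective Φ × (∀ L → δ B (map Φ L) ≡ δ A L)

-- 𝒟-systems (A, (f, A₀)): the partial map f is encoded as
-- p : Fin n → Maybe (Fin n), with A₀ = {i | p i ≡ just _}.

data MapsTo {n : ℕ} (p : Fin n → Maybe (Fin n)) : List (Fin n) → List (Fin n) → Set where
  []  : MapsTo p [] []
  _∷_ : ∀ {i j L M} → p i ≡ just j → MapsTo p L M → MapsTo p (i ∷ L) (j ∷ M)

record 𝒟System : Set where
  field
    div  : FinDiv
    part : Fin (size div) → Maybe (Fin (size div))
    part-inj : ∀ {i i' j} → part i ≡ just j → part i' ≡ just j → i ≡ i'
    part-pres : ∀ L M → MapsTo part L M → δ div M ≡ δ div L

open 𝒟System public

record SysEmbedding (S T : 𝒟System) : Set where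
  field
    Φ      : Fin (size (div S)) → Fin (size (div T))
    isEmb  : IsDivEmbedding (div S) (div T) Φ
    dom⊆   : ∀ {i j} → part S i ≡ just j → ∃ λ k → part T (Φ i) ≡ just k
    ran⊆   : ∀ {i j} → part S i ≡ just j → ∃ λ k → part T k ≡ just (Φ j)
    commute : ∀ {i j} → part S i ≡ just j → part T (Φ i) ≡ just (Φ j)

JointEmbeddingProperty : Set
JointEmbeddingProperty =
  ∀ (S T : 𝒟System) → Σ 𝒟System λ U → SysEmbedding S U × SysEmbedding T U

record CountableDiv : Set where
  field
    Δ     : List ℕ → ℚ
    isDiv : IsRationalDiversity Δ

open CountableDiv public

record Aut (U : CountableDiv) : Set where
  field
    to      : ℕ → ℕ
    from    : ℕ → ℕ
    to-from : ∀ x → to (from x) ≡ x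
    from-to : ∀ x → from (to x) ≡ x
    pres    : ∀ L → Δ U (map to L) ≡ Δ U L

open Aut public

Ultrahomogeneous : CountableDiv → Set
Ultrahomogeneous U =
  ∀ (F : List ℕ) (φ : ℕ → ℕ) →
    (∀ {x y} → x ∈ F → y ∈ F → φ x ≡ φ y → x ≡ y) →
    (∀ L → L ⊆ˡ F → Δ U (map φ L) ≡ Δ U L) →
    Σ (Aut U) λ σ → ∀ {x} → x ∈ F → to σ x ≡ φ x

-- Every finite rational diversity embeds into U. (The converse
-- inclusion of the age, that finite subdiversities of U lie in 𝒟 up to
-- isomorphism, holds automatically since U is a rational diversity.)
AgeContains𝒟 : CountableDiv → Set
AgeContains𝒟 U =
  ∀ (A : FinDiv) → Σ (Fin (size A) → ℕ) λ e →
    Injective e × (∀ L → Δ U (map e L) ≡ δ A L)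

-- U is (isomorphic to) the rational Urysohn diversity 𝕌_ℚ:
-- a countable ultrahomogeneous rational diversity with age 𝒟.
IsRationalUrysohn : CountableDiv → Set
IsRationalUrysohn U = Ultrahomogeneous U × AgeContains𝒟 U

conjFun : {U : CountableDiv} → Aut U → Aut U → ℕ → ℕ
conjFun g h = to g ∘ to h ∘ from g

-- Dense conjugacy class in the pointwise convergence topology:
-- some h whose conjugacy orbit meets every basic open set
-- {σ | σ x = g x for all x ∈ F}.
HasDenseConjugacyClass : CountableDiv → Set
HasDenseConjugacyClass U =
  Σ (Aut U) λ h → ∀ (g : Aut U) (F : List ℕ) →
    Σ (Aut U) λ k → ∀ {x} → x ∈ F → conjFun k h x ≡ to g x

module Submission where

open import Defs
open import Data.Product using (_×_; _,_)

-- Given diversities δX on X and δY on Y, and c > 0 bounding both, the sum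
-- δX(A∩X) + δY(A∩Y) + (c if A meets both X and Y) is a diversity on X ⊎ Y extending both; the
-- bonus c is what makes (D2) hold across the two parts.  Putting the union of the two partial
-- automorphisms on this sum jointly embeds two 𝒟-systems.
--
-- The trace of an automorphism σ on a finite set F
-- is a 𝒟-system.  Jointly embedding the traces of σ on F and of ρ on F′, copying the result into
-- U (age) and realizing it by an automorphism (ultrahomogeneity) yields σ′ = σ on F and k with
-- σ′ k⁻¹ = k⁻¹ ρ on F′ (`amalgamate`).  Enumerating all finite partial isomorphisms and
-- applying this step to each in turn, while settling n and its preimage at stage n, produces a
-- limit automorphism h such that for every automorphism g and finite F some conjugate k h k⁻¹
-- agrees with g on F.

module DiversityBasics where

  open import Data.List using (List; []; _∷_; _++_; map)
  open import Data.List.Membership.Propositional.Properties using (∈-map⁺; ∈-map⁻; ∈-++⁺ʳ; ∈-++⁻)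
  open import Data.List.Relation.Unary.Any using (here)
  open import Data.List.Properties using (map-++; ++-identityʳ; ++-assoc)
  open import Data.Rational using (ℚ; 0ℚ; _+_; _≤_)
  open import Data.Rational.Properties using (≤-trans; ≤-reflexive; +-identityʳ)
  open import Data.Sum using (inj₁; inj₂)
  open import Relation.Binary.PropositionalEquality

  module DiversityFacts {X : Set} {δX : List X → ℚ} (D : IsRationalDiversity δX) where
    open IsRationalDiversity D

    δ-[] : δX [] ≡ 0ℚ
    δ-[] = ≤1⇒zero [] λ ()

    δ-singleton : ∀ x → δX (x ∷ []) ≡ 0ℚ
    δ-singleton x = ≤1⇒zero _ λ { (here refl) (here refl) → refl }

    -- Adding a point does not decrease diversity: (D2) with B = [x] and C = [].
    δ-snoc : ∀ A x → δX A ≤ δX (A ++ x ∷ [])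
    δ-snoc A x = subst₂ _≤_ (cong δX (++-identityʳ A))
                   (trans (cong (δX (A ++ x ∷ []) +_) (δ-singleton x)) (+-identityʳ _))
                   (triangle A (x ∷ []) [] (x , here refl))

    δ-++ : ∀ A B → δX A ≤ δX (A ++ B)
    δ-++ A [] = ≤-reflexive (cong δX (sym (++-identityʳ A)))
    δ-++ A (x ∷ B) = ≤-trans (δ-snoc A x)
      (subst (δX (A ++ x ∷ []) ≤_) (cong δX (++-assoc A (x ∷ []) B)) (δ-++ (A ++ x ∷ []) B))

    δ-mono : ∀ {A B} → A ⊆ˡ B → δX A ≤ δX B
    δ-mono {A} {B} A⊆B = ≤-trans (δ-++ A B) (≤-reflexive (respects _ _ AB⊆B (∈-++⁺ʳ A)))
      where
      AB⊆B : (A ++ B) ⊆ˡ B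
      AB⊆B m with ∈-++⁻ A m
      ... | inj₁ a = A⊆B a
      ... | inj₂ b = b

  map-⊆ : {X Y : Set} (f : X → Y) {A B : List X} → A ⊆ˡ B → map f A ⊆ˡ map f B
  map-⊆ f A⊆B m with ∈-map⁻ f m
  ... | x , x∈A , refl = ∈-map⁺ f (A⊆B x∈A)

  pullbackDiversity : {X Y : Set} (e : Y → X) → Injective e → {δX : List X → ℚ} →
    IsRationalDiversity δX → IsRationalDiversity (λ L → δX (map e L))
  pullbackDiversity e e-inj {δX} D = record
    { respects = λ A B p q → respects (map e A) (map e B) (map-⊆ e p) (map-⊆ e q)
    ; nonneg   = λ A → nonneg (map e A)
    ; zero⇒≤1  = λ A eq x∈A y∈A → e-inj (zero⇒≤1 (map e A) eq (∈-map⁺ e x∈A) (∈-map⁺ e y∈A))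
    ; ≤1⇒zero  = λ A amo → ≤1⇒zero (map e A) (image-amo amo)
    ; triangle = triangle′
    }
    where
    open IsRationalDiversity D
    image-amo : ∀ {A} → AtMostOne A → AtMostOne (map e A)
    image-amo amo u∈ v∈ with ∈-map⁻ e u∈ | ∈-map⁻ e v∈
    ... | x , x∈ , refl | y , y∈ , refl = cong e (amo x∈ y∈)
    triangle′ : ∀ A B C → NonEmpty B → δX (map e (A ++ C)) ≤ δX (map e (A ++ B)) + δX (map e (B ++ C))
    triangle′ A B C (b , b∈) rewrite map-++ e A C | map-++ e A B | map-++ e B C =
      triangle (map e A) (map e B) (map e C) (e b , ∈-map⁺ e b∈)

module JointEmbedding where

  import Data.Nat as ℕ
  open import Data.Fin using (Fin; _↑ˡ_; _↑ʳ_; splitAt; join)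
  open import Data.Fin.Properties using (splitAt-↑ˡ; splitAt-↑ʳ; join-splitAt; ↑ˡ-injective; ↑ʳ-injective)
  open import Data.Maybe using (Maybe; just; nothing) renaming (map to mapMaybe)
  open import Data.List using (List; []; _∷_; _++_; map; allFin)
  open import Data.List.Membership.Propositional using (_∈_)
  open import Data.List.Membership.Propositional.Properties using (∈-allFin)
  open import Data.List.Relation.Unary.Any using (here; there)
  open import Data.List.Relation.Binary.Pointwise using (Pointwise; []; _∷_)
  open import Data.List.Properties using (map-∘; map-cong)
  open import Data.Rational using (ℚ; 0ℚ; 1ℚ; _+_; _≤_; _<_)
  open import Data.Rational.Properties
  open import Data.Rational.Solver using (module +-*-Solver)
  open import Data.Sum using (_⊎_; inj₁; inj₂)
  open import Data.Sum.Properties using (inj₁-injective; inj₂-injective)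
  open import Data.Empty using (⊥; ⊥-elim)
  open import Relation.Binary.PropositionalEquality
  open DiversityBasics

  ≤-+-nonneg : ∀ {a z} → 0ℚ ≤ z → a ≤ a + z
  ≤-+-nonneg {a} {z} z≥0 = subst (_≤ a + z) (+-identityʳ a) (+-monoʳ-≤ a z≥0)

  nonneg-sum-zero : ∀ {x y} → 0ℚ ≤ x → 0ℚ ≤ y → x + y ≡ 0ℚ → x ≡ 0ℚ × y ≡ 0ℚ
  nonneg-sum-zero {x} {y} x≥0 y≥0 eq =
    ≤-antisym (subst₂ _≤_ (+-identityʳ x) eq (+-monoʳ-≤ x y≥0)) x≥0 ,
    ≤-antisym (subst₂ _≤_ (+-identityˡ y) eq (+-monoˡ-≤ y x≥0)) y≥0

  module Cross (c : ℚ) where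

    occupied : {Y : Set} → List Y → ℚ
    occupied [] = 0ℚ
    occupied (_ ∷ _) = c

    cross : {X Y : Set} → List X → List Y → ℚ
    cross [] _ = 0ℚ
    cross (_ ∷ _) Z = occupied Z

    cross-sym : {X Y : Set} (L : List X) (R : List Y) → cross L R ≡ cross R L
    cross-sym [] [] = refl
    cross-sym [] (_ ∷ _) = refl
    cross-sym (_ ∷ _) [] = refl
    cross-sym (_ ∷ _) (_ ∷ _) = refl

    cross-[] : {X Y : Set} (L : List X) → cross {Y = Y} L [] ≡ 0ℚ
    cross-[] [] = refl
    cross-[] (_ ∷ _) = refl

    occupied-nonempty : {Y : Set} (P : List Y) (y : Y) (Q : List Y) → occupied (P ++ y ∷ Q) ≡ c
    occupied-nonempty [] y Q = refl
    occupied-nonempty (_ ∷ _) y Q = refl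

    cross-nonempty : {X Y : Set} (P : List X) (x : X) (Q : List X) (Z : List Y) →
      cross (P ++ x ∷ Q) Z ≡ occupied Z
    cross-nonempty [] x Q Z = refl
    cross-nonempty (_ ∷ _) x Q Z = refl

    occupied-⊆ : {Y : Set} {R₁ R₂ : List Y} → R₁ ⊆ˡ R₂ → R₂ ⊆ˡ R₁ → occupied R₁ ≡ occupied R₂
    occupied-⊆ {R₁ = []} {[]} _ _ = refl
    occupied-⊆ {R₁ = []} {_ ∷ _} _ R₂⊆R₁ with R₂⊆R₁ (here refl)
    ... | ()
    occupied-⊆ {R₁ = _ ∷ _} {[]} R₁⊆R₂ _ with R₁⊆R₂ (here refl)
    ... | ()
    occupied-⊆ {R₁ = _ ∷ _} {_ ∷ _} _ _ = refl

    cross-⊆ : {X Y : Set} {L₁ L₂ : List X} {R₁ R₂ : List Y} → L₁ ⊆ˡ L₂ → L₂ ⊆ˡ L₁ →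
      R₁ ⊆ˡ R₂ → R₂ ⊆ˡ R₁ → cross L₁ R₁ ≡ cross L₂ R₂
    cross-⊆ {L₁ = []} {[]} _ _ _ _ = refl
    cross-⊆ {L₁ = []} {_ ∷ _} _ L₂⊆L₁ _ _ with L₂⊆L₁ (here refl)
    ... | ()
    cross-⊆ {L₁ = _ ∷ _} {[]} L₁⊆L₂ _ _ _ with L₁⊆L₂ (here refl)
    ... | ()
    cross-⊆ {L₁ = _ ∷ _} {_ ∷ _} _ _ R₁⊆R₂ R₂⊆R₁ = occupied-⊆ R₁⊆R₂ R₂⊆R₁

    cross-zero : {X Y : Set} {L : List X} {R : List Y} → cross L R ≡ 0ℚ → ∀ {x y} → x ∈ L → y ∈ R → c ≡ 0ℚ
    cross-zero {L = _ ∷ _} {_ ∷ _} eq _ _ = eq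

    cross-disjoint : {X Y : Set} (L : List X) (R : List Y) → (∀ {x y} → x ∈ L → y ∈ R → ⊥) → cross L R ≡ 0ℚ
    cross-disjoint [] _ _ = refl
    cross-disjoint (_ ∷ _) [] _ = refl
    cross-disjoint (_ ∷ _) (_ ∷ _) disjoint = ⊥-elim (disjoint (here refl) (here refl))

    module _ (c≥0 : 0ℚ ≤ c) where

      occupied-≤ : {Y : Set} (Z : List Y) → occupied Z ≤ c
      occupied-≤ [] = c≥0
      occupied-≤ (_ ∷ _) = ≤-refl

      cross-≤ : {X Y : Set} (L : List X) (Z : List Y) → cross L Z ≤ occupied Z
      cross-≤ [] [] = ≤-refl
      cross-≤ [] (_ ∷ _) = c≥0
      cross-≤ (_ ∷ _) Z = ≤-refl

      cross-nonneg : {X Y : Set} (L : List X) (Z : List Y) → 0ℚ ≤ cross L Z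
      cross-nonneg [] _ = ≤-refl
      cross-nonneg (_ ∷ _) [] = ≤-refl
      cross-nonneg (_ ∷ _) (_ ∷ _) = c≥0

  -- The cross term only depends on which of the two sets are non-empty, so any pair of
  -- maps between the summands that are defined on all of L and L′ preserves it.
  cross-MapsTo : ∀ (c : ℚ) {n m} {p : Fin n → Maybe (Fin n)} {q : Fin m → Maybe (Fin m)} {L M L′ M′} →
    MapsTo p L M → MapsTo q L′ M′ → Cross.cross c M M′ ≡ Cross.cross c L L′
  cross-MapsTo c [] _ = refl
  cross-MapsTo c (_ ∷ _) [] = refl
  cross-MapsTo c (_ ∷ _) (_ ∷ _) = refl

  -- The triangle inequality for the sum diversity when the middle set has a point in the
  -- first summand.  Here c bounds the second diversity δY.
  module CrossTriangle {X Y : Set} {δX : List X → ℚ} {δY : List Y → ℚ}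
    (DX : IsRationalDiversity δX) (DY : IsRationalDiversity δY)
    (c : ℚ) (c≥0 : 0ℚ ≤ c) (δY≤c : ∀ L → δY L ≤ c) where
    open Cross c
    open +-*-Solver
    module DX = IsRationalDiversity DX
    module DY = IsRationalDiversity DY

    -- δY + occupied satisfies the triangle inequality even when the middle set is empty:
    -- if Q is empty the bonus c on the right dominates δY (P ++ R) ≤ c.
    boosted-triangle : ∀ P Q R → δY (P ++ R) + occupied (P ++ R) ≤
      (δY (P ++ Q) + occupied (P ++ Q)) + (δY (Q ++ R) + occupied (Q ++ R))
    boosted-triangle P (y ∷ Q) R rewrite occupied-nonempty P y Q =
      ≤-trans (+-mono-≤ (DY.triangle P (y ∷ Q) R (y , here refl))
                        (≤-trans (occupied-≤ c≥0 (P ++ R)) (≤-+-nonneg c≥0)))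
              (≤-reflexive (solve 3 (λ a b c → (a :+ b) :+ (c :+ c) := (a :+ c) :+ (b :+ c))
                                    refl (δY (P ++ y ∷ Q)) (δY (y ∷ Q ++ R)) c))
    boosted-triangle [] [] R rewrite DiversityFacts.δ-[] DY = ≤-reflexive (sym (+-identityˡ _))
    boosted-triangle (p ∷ P) [] [] rewrite DiversityFacts.δ-[] DY = ≤-+-nonneg ≤-refl
    boosted-triangle (p ∷ P) [] (r ∷ R) =
      ≤-trans (≤-trans (+-monoˡ-≤ c (δY≤c _)) (≤-+-nonneg (+-mono-≤ (DY.nonneg _) (DY.nonneg _))))
              (≤-reflexive (solve 3 (λ a b c → c :+ c :+ (a :+ b) := (a :+ c) :+ (b :+ c))
                                    refl (δY (p ∷ P ++ [])) (δY (r ∷ R)) c))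

    private
      add-triangles : ∀ {x₁ x₂ x₃ y₁ y₂ y₃ b₁ b₂ b₃} → x₁ ≤ x₂ + x₃ → y₁ + b₁ ≤ (y₂ + b₂) + (y₃ + b₃) →
        x₁ + y₁ + b₁ ≤ (x₂ + y₂ + b₂) + (x₃ + y₃ + b₃)
      add-triangles {x₁} {x₂} {x₃} {y₁} {y₂} {y₃} {b₁} {b₂} {b₃} p q =
        subst₂ _≤_ (solve 3 (λ a b c → a :+ (b :+ c) := a :+ b :+ c) refl x₁ y₁ b₁)
          (solve 6 (λ x₂ x₃ y₂ y₃ b₂ b₃ → (x₂ :+ x₃) :+ ((y₂ :+ b₂) :+ (y₃ :+ b₃))
                                         := (x₂ :+ y₂ :+ b₂) :+ (x₃ :+ y₃ :+ b₃)) refl x₂ x₃ y₂ y₃ b₂ b₃)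
          (+-mono-≤ p q)

    triangle-left : ∀ Px Qx Rx Py Qy Ry → NonEmpty Qx →
      δX (Px ++ Rx) + δY (Py ++ Ry) + cross (Px ++ Rx) (Py ++ Ry) ≤
      (δX (Px ++ Qx) + δY (Py ++ Qy) + cross (Px ++ Qx) (Py ++ Qy)) +
      (δX (Qx ++ Rx) + δY (Qy ++ Ry) + cross (Qx ++ Rx) (Qy ++ Ry))
    triangle-left Px (x ∷ Qx) Rx Py Qy Ry ne
      rewrite cross-nonempty Px x Qx (Py ++ Qy) | cross-nonempty [] x (Qx ++ Rx) (Qy ++ Ry) =
      add-triangles {x₂ = δX (Px ++ x ∷ Qx)} {δX (x ∷ Qx ++ Rx)} {y₂ = δY (Py ++ Qy)} {δY (Qy ++ Ry)}
                    {b₂ = occupied (Py ++ Qy)} {occupied (Qy ++ Ry)}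
        (DX.triangle Px (x ∷ Qx) Rx ne)
        (≤-trans (+-monoʳ-≤ (δY (Py ++ Ry)) (cross-≤ c≥0 (Px ++ Rx) (Py ++ Ry)))
                 (boosted-triangle Py Qy Ry))

  lefts : {X Y : Set} → List (X ⊎ Y) → List X
  lefts [] = []
  lefts (inj₁ x ∷ L) = x ∷ lefts L
  lefts (inj₂ _ ∷ L) = lefts L

  rights : {X Y : Set} → List (X ⊎ Y) → List Y
  rights [] = []
  rights (inj₁ _ ∷ L) = rights L
  rights (inj₂ y ∷ L) = y ∷ rights L

  module _ {X Y : Set} where

    lefts-++ : (L M : List (X ⊎ Y)) → lefts (L ++ M) ≡ lefts L ++ lefts M
    lefts-++ [] M = refl
    lefts-++ (inj₁ x ∷ L) M = cong (x ∷_) (lefts-++ L M)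
    lefts-++ (inj₂ _ ∷ L) M = lefts-++ L M

    rights-++ : (L M : List (X ⊎ Y)) → rights (L ++ M) ≡ rights L ++ rights M
    rights-++ [] M = refl
    rights-++ (inj₁ _ ∷ L) M = rights-++ L M
    rights-++ (inj₂ y ∷ L) M = cong (y ∷_) (rights-++ L M)

    ∈-lefts⁺ : ∀ {x} {L : List (X ⊎ Y)} → inj₁ x ∈ L → x ∈ lefts L
    ∈-lefts⁺ {L = inj₁ _ ∷ L} (here refl) = here refl
    ∈-lefts⁺ {L = inj₁ _ ∷ L} (there m) = there (∈-lefts⁺ m)
    ∈-lefts⁺ {L = inj₂ _ ∷ L} (there m) = ∈-lefts⁺ m

    ∈-lefts⁻ : ∀ {x} (L : List (X ⊎ Y)) → x ∈ lefts L → inj₁ x ∈ L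
    ∈-lefts⁻ (inj₁ _ ∷ L) (here refl) = here refl
    ∈-lefts⁻ (inj₁ _ ∷ L) (there m) = there (∈-lefts⁻ L m)
    ∈-lefts⁻ (inj₂ _ ∷ L) m = there (∈-lefts⁻ L m)

    ∈-rights⁺ : ∀ {y} {L : List (X ⊎ Y)} → inj₂ y ∈ L → y ∈ rights L
    ∈-rights⁺ {L = inj₂ _ ∷ L} (here refl) = here refl
    ∈-rights⁺ {L = inj₁ _ ∷ L} (there m) = ∈-rights⁺ m
    ∈-rights⁺ {L = inj₂ _ ∷ L} (there m) = there (∈-rights⁺ m)

    ∈-rights⁻ : ∀ {y} (L : List (X ⊎ Y)) → y ∈ rights L → inj₂ y ∈ L
    ∈-rights⁻ (inj₁ _ ∷ L) m = there (∈-rights⁻ L m)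
    ∈-rights⁻ (inj₂ _ ∷ L) (here refl) = here refl
    ∈-rights⁻ (inj₂ _ ∷ L) (there m) = there (∈-rights⁻ L m)

    lefts-⊆ : {L M : List (X ⊎ Y)} → L ⊆ˡ M → lefts L ⊆ˡ lefts M
    lefts-⊆ {L} L⊆M m = ∈-lefts⁺ (L⊆M (∈-lefts⁻ L m))

    rights-⊆ : {L M : List (X ⊎ Y)} → L ⊆ˡ M → rights L ⊆ˡ rights M
    rights-⊆ {L} L⊆M m = ∈-rights⁺ (L⊆M (∈-rights⁻ L m))

    lefts-inj₁ : (L : List X) → lefts {Y = Y} (map inj₁ L) ≡ L
    lefts-inj₁ [] = refl
    lefts-inj₁ (x ∷ L) = cong (x ∷_) (lefts-inj₁ L)

    rights-inj₁ : (L : List X) → rights {Y = Y} (map inj₁ L) ≡ []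
    rights-inj₁ [] = refl
    rights-inj₁ (_ ∷ L) = rights-inj₁ L

    lefts-inj₂ : (L : List Y) → lefts {X = X} (map inj₂ L) ≡ []
    lefts-inj₂ [] = refl
    lefts-inj₂ (_ ∷ L) = lefts-inj₂ L

    rights-inj₂ : (L : List Y) → rights {X = X} (map inj₂ L) ≡ L
    rights-inj₂ [] = refl
    rights-inj₂ (y ∷ L) = cong (y ∷_) (rights-inj₂ L)

  module SumDiversity {X Y : Set} {δX : List X → ℚ} {δY : List Y → ℚ}
    (DX : IsRationalDiversity δX) (DY : IsRationalDiversity δY)
    (c : ℚ) (c>0 : 0ℚ < c) (δX≤c : ∀ L → δX L ≤ c) (δY≤c : ∀ L → δY L ≤ c) where
    open Cross c
    module DX = IsRationalDiversity DX
    module DY = IsRationalDiversity DY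

    δ⊕ : List (X ⊎ Y) → ℚ
    δ⊕ L = δX (lefts L) + δY (rights L) + cross (lefts L) (rights L)

    private
      c≥0 : 0ℚ ≤ c
      c≥0 = <⇒≤ c>0

      respects : ∀ L M → L ⊆ˡ M → M ⊆ˡ L → δ⊕ L ≡ δ⊕ M
      respects L M L⊆M M⊆L =
        cong₂ _+_ (cong₂ _+_ (DX.respects _ _ (lefts-⊆ L⊆M) (lefts-⊆ M⊆L))
                             (DY.respects _ _ (rights-⊆ L⊆M) (rights-⊆ M⊆L)))
                  (cross-⊆ (lefts-⊆ L⊆M) (lefts-⊆ M⊆L) (rights-⊆ L⊆M) (rights-⊆ M⊆L))

      nonneg : ∀ L → 0ℚ ≤ δ⊕ L
      nonneg L = +-mono-≤ (+-mono-≤ (DX.nonneg _) (DY.nonneg _)) (cross-nonneg c≥0 (lefts L) (rights L))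

      zero⇒≤1 : ∀ L → δ⊕ L ≡ 0ℚ → AtMostOne L
      zero⇒≤1 L eq {x} {y} x∈ y∈
        with nonneg-sum-zero (+-mono-≤ (DX.nonneg _) (DY.nonneg _)) (cross-nonneg c≥0 (lefts L) (rights L)) eq
      ... | δXY≡0 , cross≡0 with nonneg-sum-zero (DX.nonneg _) (DY.nonneg _) δXY≡0
      ... | δX≡0 , δY≡0 with x | y
      ... | inj₁ a | inj₁ b = cong inj₁ (DX.zero⇒≤1 _ δX≡0 (∈-lefts⁺ x∈) (∈-lefts⁺ y∈))
      ... | inj₂ a | inj₂ b = cong inj₂ (DY.zero⇒≤1 _ δY≡0 (∈-rights⁺ x∈) (∈-rights⁺ y∈))
      ... | inj₁ a | inj₂ b = ⊥-elim (<-irrefl (sym (cross-zero cross≡0 (∈-lefts⁺ x∈) (∈-rights⁺ y∈))) c>0)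
      ... | inj₂ a | inj₁ b = ⊥-elim (<-irrefl (sym (cross-zero cross≡0 (∈-lefts⁺ y∈) (∈-rights⁺ x∈))) c>0)

      inj₁≢inj₂ : {x : X} {y : Y} → _≡_ {A = X ⊎ Y} (inj₁ x) (inj₂ y) → ⊥
      inj₁≢inj₂ ()

      ≤1⇒zero : ∀ L → AtMostOne L → δ⊕ L ≡ 0ℚ
      ≤1⇒zero L amo
        rewrite DX.≤1⇒zero (lefts L) (λ p q → inj₁-injective (amo (∈-lefts⁻ L p) (∈-lefts⁻ L q)))
              | DY.≤1⇒zero (rights L) (λ p q → inj₂-injective (amo (∈-rights⁻ L p) (∈-rights⁻ L q)))
              | cross-disjoint (lefts L) (rights L) (λ p q → inj₁≢inj₂ (amo (∈-lefts⁻ L p) (∈-rights⁻ L q)))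
              = refl

      swap-sides : (R : List Y) (L : List X) → δY R + δX L + cross R L ≡ δX L + δY R + cross L R
      swap-sides R L = cong₂ _+_ (+-comm (δY R) (δX L)) (cross-sym R L)

      triangle : ∀ P Q R → NonEmpty Q → δ⊕ (P ++ R) ≤ δ⊕ (P ++ Q) + δ⊕ (Q ++ R)
      triangle P Q R (q , q∈)
        rewrite lefts-++ P R | rights-++ P R | lefts-++ P Q | rights-++ P Q | lefts-++ Q R | rights-++ Q R
        with q
      ... | inj₁ x = CrossTriangle.triangle-left DX DY c c≥0 δY≤c
                       (lefts P) (lefts Q) (lefts R) (rights P) (rights Q) (rights R) (x , ∈-lefts⁺ q∈)
      ... | inj₂ y = subst₂ _≤_ (swap-sides (rights P ++ rights R) (lefts P ++ lefts R))
                       (cong₂ _+_ (swap-sides (rights P ++ rights Q) (lefts P ++ lefts Q))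
                                  (swap-sides (rights Q ++ rights R) (lefts Q ++ lefts R)))
                       (CrossTriangle.triangle-left DY DX c c≥0 δX≤c
                          (rights P) (rights Q) (rights R) (lefts P) (lefts Q) (lefts R) (y , ∈-rights⁺ q∈))

    isDiversity : IsRationalDiversity δ⊕
    isDiversity = record { respects = respects ; nonneg = nonneg ; zero⇒≤1 = zero⇒≤1
                         ; ≤1⇒zero = ≤1⇒zero ; triangle = triangle }

    δ⊕-inj₁ : ∀ L → δ⊕ (map inj₁ L) ≡ δX L
    δ⊕-inj₁ L rewrite lefts-inj₁ {Y = Y} L | rights-inj₁ {Y = Y} L | DiversityFacts.δ-[] DY | cross-[] {Y = Y} L =
      trans (+-identityʳ _) (+-identityʳ _)

    δ⊕-inj₂ : ∀ L → δ⊕ (map inj₂ L) ≡ δY L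
    δ⊕-inj₂ L rewrite lefts-inj₂ {X = X} L | rights-inj₂ {X = X} L | DiversityFacts.δ-[] DX =
      trans (+-identityʳ _) (+-identityˡ _)

  δ≤δ-all : (A : FinDiv) (L : List (Fin (size A))) → δ A L ≤ δ A (allFin (size A))
  δ≤δ-all A L = DiversityFacts.δ-mono (isDiv A) (λ {x} _ → ∈-allFin x)

  module DisjointSum (S T : 𝒟System) where
    private
      A B : FinDiv
      A = div S
      B = div T
      n m : ℕ.ℕ
      n = size A
      m = size B
      module DA = IsRationalDiversity (isDiv A)
      module DB = IsRationalDiversity (isDiv B)
      0<1 : 0ℚ < 1ℚ
      0<1 = positive⁻¹ 1ℚ

    c : ℚ
    c = δ A (allFin n) + δ B (allFin m) + 1ℚ

    c>0 : 0ℚ < c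
    c>0 = <-≤-trans 0<1 (+-monoˡ-≤ 1ℚ (+-mono-≤ (DA.nonneg _) (DB.nonneg _)))

    δA≤c : ∀ L → δ A L ≤ c
    δA≤c L = ≤-trans (δ≤δ-all A L) (≤-trans (≤-+-nonneg (DB.nonneg _)) (≤-+-nonneg (<⇒≤ 0<1)))

    δB≤c : ∀ L → δ B L ≤ c
    δB≤c L = ≤-trans (δ≤δ-all B L)
      (≤-trans (subst (_≤ δ A (allFin n) + δ B (allFin m)) (+-identityˡ _)
                      (+-monoˡ-≤ (δ B (allFin m)) (DA.nonneg (allFin n))))
               (≤-+-nonneg (<⇒≤ 0<1)))

    module Sum = SumDiversity (isDiv A) (isDiv B) c c>0 δA≤c δB≤c

    split : Fin (n ℕ.+ m) → Fin n ⊎ Fin m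
    split = splitAt n

    split-injective : Injective split
    split-injective {x} {y} eq = trans (sym (join-splitAt n m x)) (trans (cong (join n m) eq) (join-splitAt n m y))

    sumDiv : FinDiv
    sumDiv = record { size = n ℕ.+ m ; δ = λ L → Sum.δ⊕ (map split L)
                    ; isDiv = pullbackDiversity split split-injective Sum.isDiversity }

    sumPart′ : Fin n ⊎ Fin m → Maybe (Fin (n ℕ.+ m))
    sumPart′ (inj₁ i) = mapMaybe (_↑ˡ m) (part S i)
    sumPart′ (inj₂ j) = mapMaybe (n ↑ʳ_) (part T j)

    sumPart : Fin (n ℕ.+ m) → Maybe (Fin (n ℕ.+ m))
    sumPart x = sumPart′ (split x)

    data SumStep : Fin n ⊎ Fin m → Fin n ⊎ Fin m → Set where
      left  : ∀ {i j} → part S i ≡ just j → SumStep (inj₁ i) (inj₁ j)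
      right : ∀ {i j} → part T i ≡ just j → SumStep (inj₂ i) (inj₂ j)

    -- f ∪ g as a relation on the summands (the injectivity and preservation proofs are done there).
    sumStep : ∀ s {y} → sumPart′ s ≡ just y → SumStep s (split y)
    sumStep (inj₁ i) eq with part S i in pi
    sumStep (inj₁ i) refl | just j rewrite splitAt-↑ˡ n j m = left pi
    sumStep (inj₁ i) () | nothing
    sumStep (inj₂ i) eq with part T i in pi
    sumStep (inj₂ i) refl | just j rewrite splitAt-↑ʳ n m j = right pi
    sumStep (inj₂ i) () | nothing

    sumStep-injective : ∀ {s s′ t} → SumStep s t → SumStep s′ t → s ≡ s′
    sumStep-injective (left p) (left q) = cong inj₁ (part-inj S p q)
    sumStep-injective (right p) (right q) = cong inj₂ (part-inj T p q)

    sumPart-injective : ∀ {x x′ y} → sumPart x ≡ just y → sumPart x′ ≡ just y → x ≡ x′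
    sumPart-injective {x} {x′} p q = split-injective (sumStep-injective (sumStep (split x) p) (sumStep (split x′) q))

    maps-steps : ∀ {L M} → MapsTo sumPart L M → Pointwise SumStep (map split L) (map split M)
    maps-steps [] = []
    maps-steps (p ∷ ps) = sumStep _ p ∷ maps-steps ps

    steps-lefts : ∀ {P Q} → Pointwise SumStep P Q → MapsTo (part S) (lefts P) (lefts Q)
    steps-lefts [] = []
    steps-lefts (left p ∷ ps) = p ∷ steps-lefts ps
    steps-lefts (right _ ∷ ps) = steps-lefts ps

    steps-rights : ∀ {P Q} → Pointwise SumStep P Q → MapsTo (part T) (rights P) (rights Q)
    steps-rights [] = []
    steps-rights (left _ ∷ ps) = steps-rights ps
    steps-rights (right p ∷ ps) = p ∷ steps-rights ps

    sumPart-preserves : ∀ L M → MapsTo sumPart L M → δ sumDiv M ≡ δ sumDiv L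
    sumPart-preserves L M mt =
      cong₂ _+_ (cong₂ _+_ (part-pres S _ _ (steps-lefts ps)) (part-pres T _ _ (steps-rights ps)))
                (cross-MapsTo c (steps-lefts ps) (steps-rights ps))
      where ps = maps-steps mt

    sumSystem : 𝒟System
    sumSystem = record { div = sumDiv ; part = sumPart ; part-inj = sumPart-injective ; part-pres = sumPart-preserves }

    embedLeft : SysEmbedding S sumSystem
    embedLeft = record
      { Φ = _↑ˡ m
      ; isEmb = ↑ˡ-injective m _ _ , preserves
      ; dom⊆ = λ p → _ , commute p
      ; ran⊆ = λ p → _ , commute p
      ; commute = commute
      }
      where
      preserves : ∀ L → δ sumDiv (map (_↑ˡ m) L) ≡ δ A L
      preserves L = trans (cong Sum.δ⊕ (trans (sym (map-∘ L)) (map-cong (λ i → splitAt-↑ˡ n i m) L))) (Sum.δ⊕-inj₁ L)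
      commute : ∀ {i j} → part S i ≡ just j → sumPart (i ↑ˡ m) ≡ just (j ↑ˡ m)
      commute {i} p rewrite splitAt-↑ˡ n i m | p = refl

    embedRight : SysEmbedding T sumSystem
    embedRight = record
      { Φ = n ↑ʳ_
      ; isEmb = ↑ʳ-injective n _ _ , preserves
      ; dom⊆ = λ p → _ , commute p
      ; ran⊆ = λ p → _ , commute p
      ; commute = commute
      }
      where
      preserves : ∀ L → δ sumDiv (map (n ↑ʳ_) L) ≡ δ B L
      preserves L = trans (cong Sum.δ⊕ (trans (sym (map-∘ L)) (map-cong (splitAt-↑ʳ n m) L))) (Sum.δ⊕-inj₂ L)
      commute : ∀ {i j} → part T i ≡ just j → sumPart (n ↑ʳ i) ≡ just (n ↑ʳ j)
      commute {i} p rewrite splitAt-↑ʳ n m i | p = refl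

  jointEmbedding : JointEmbeddingProperty
  jointEmbedding S T = sumSystem , embedLeft , embedRight
    where open DisjointSum S T

module DenseConjugacy where

  open import Data.Nat using (ℕ; zero; suc; _≟_; _+_; _∸_; _≤_)
  open import Data.Nat.Properties using (+-suc; +-identityʳ; suc-injective; m≤m+n; m≤n+m; m∸n+n≡m; ≤-trans)
  open import Data.Fin using (Fin; zero; suc)
  open import Data.Maybe using (Maybe; just; nothing)
  open import Data.List using (List; []; _∷_; _++_; map; lookup; length; filter; allFin; deduplicate)
  open import Data.List.Membership.Propositional using (_∈_)
  open import Data.List.Membership.Propositional.Properties
    using (∈-map⁺; ∈-map⁻; ∈-++⁺ˡ; ∈-++⁺ʳ; ∈-++⁻; ∈-allFin; ∈-filter⁺; ∈-filter⁻; ∈-lookup; ∈-deduplicate⁺)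
  open import Data.List.Membership.DecPropositional _≟_ using (_∈?_)
  open import Data.List.Relation.Unary.Any using (here; there; index)
  open import Data.List.Relation.Unary.Any.Properties using (lookup-index)
  open import Data.List.Relation.Unary.All as All using (All; all?)
  open import Data.List.Relation.Unary.AllPairs using (_∷_)
  open import Data.List.Relation.Unary.Unique.Propositional using (Unique)
  open import Data.List.Relation.Unary.Unique.DecPropositional.Properties _≟_ using (deduplicate-!)
  open import Data.List.Properties using (map-∘; map-id; map-cong; map-cong-local)
  open import Data.Product using (Σ; ∃; proj₁; proj₂)
  open import Data.Empty using (⊥-elim)
  open import Relation.Binary.PropositionalEquality
  open import Relation.Nullary using (Dec; yes; no)
  open import Relation.Nullary.Decidable using (_→-dec_)
  import Data.Rational.Properties as ℚ
  open import Data.Sum using (inj₁; inj₂)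
  open import Function using (_∘_; id)
  open DiversityBasics using (map-⊆; pullbackDiversity)

  applyPairs : List (ℕ × ℕ) → ℕ → ℕ
  applyPairs [] x = x
  applyPairs ((a , b) ∷ ps) x with a ≟ x
  ... | yes _ = b
  ... | no _ = applyPairs ps x

  graphOn : {T : Set} (c d : T → ℕ) → List T → List (ℕ × ℕ)
  graphOn c d I = map (λ i → c i , d i) I

  applyPairs-graphOn : {T : Set} (c d : T → ℕ) (I : List T) {x : ℕ} → x ∈ map c I →
    Σ T λ j → j ∈ I × c j ≡ x × applyPairs (graphOn c d I) x ≡ d j
  applyPairs-graphOn c d (i ∷ I) {x} x∈ with c i ≟ x
  ... | yes eq = i , here refl , eq , refl
  applyPairs-graphOn c d (i ∷ I) (here refl) | no neq = ⊥-elim (neq refl)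
  applyPairs-graphOn c d (i ∷ I) (there x∈) | no neq with applyPairs-graphOn c d I x∈
  ... | j , j∈ , cj≡x , eq = j , there j∈ , cj≡x , eq

  graphOn-domain : (f : ℕ → ℕ) (F : List ℕ) → map proj₁ (graphOn id f F) ≡ F
  graphOn-domain f F = trans (sym (map-∘ F)) (map-id F)

  applyPairs-graph : (f : ℕ → ℕ) (F : List ℕ) {x : ℕ} → x ∈ F → applyPairs (graphOn id f F) x ≡ f x
  applyPairs-graph f F x∈ with applyPairs-graphOn id f F (subst (_ ∈_) (sym (map-id F)) x∈)
  ... | j , _ , refl , eq = eq

  -- The sublists of a list; every finite subset of F has the same points as one of them
  -- (namely `restrict L F`, the elements of F lying in L), which makes "for all L ⊆ F"
  -- decidable.
  sublists : List ℕ → List (List ℕ)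
  sublists [] = [] ∷ []
  sublists (x ∷ xs) = sublists xs ++ map (x ∷_) (sublists xs)

  sublists-⊆ : ∀ F {S} → S ∈ sublists F → S ⊆ˡ F
  sublists-⊆ [] (here refl) ()
  sublists-⊆ (x ∷ F) S∈ with ∈-++⁻ (sublists F) S∈
  ... | inj₁ S∈′ = there ∘ sublists-⊆ F S∈′
  ... | inj₂ S∈′ with ∈-map⁻ (x ∷_) S∈′
  ...   | S′ , S′∈ , refl = λ { (here refl) → here refl ; (there y∈) → there (sublists-⊆ F S′∈ y∈) }

  restrict : List ℕ → List ℕ → List ℕ
  restrict L F = filter (_∈? L) F

  restrict∈sublists : ∀ L F → restrict L F ∈ sublists F
  restrict∈sublists L [] = here refl
  restrict∈sublists L (x ∷ F) with x ∈? L
  ... | yes _ = ∈-++⁺ʳ (sublists F) (∈-map⁺ (x ∷_) (restrict∈sublists L F))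
  ... | no _ = ∈-++⁺ˡ (restrict∈sublists L F)

  restrict-⊆ : ∀ L F → restrict L F ⊆ˡ L
  restrict-⊆ L F x∈ = proj₂ (∈-filter⁻ (_∈? L) {xs = F} x∈)

  ⊆-restrict : ∀ {L F} → L ⊆ˡ F → L ⊆ˡ restrict L F
  ⊆-restrict L⊆F x∈ = ∈-filter⁺ (_∈? _) (L⊆F x∈) x∈

  lookup-injective : {X : Set} (D : List X) → Unique D → Injective (lookup D)
  lookup-injective (x ∷ D) (_ ∷ _) {zero} {zero} eq = refl
  lookup-injective (x ∷ D) (x∉D ∷ _) {zero} {suc j} eq = ⊥-elim (All.lookup x∉D (∈-lookup {xs = D} j) eq)
  lookup-injective (x ∷ D) (x∉D ∷ _) {suc i} {zero} eq = ⊥-elim (All.lookup x∉D (∈-lookup {xs = D} i) (sym eq))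
  lookup-injective (x ∷ D) (_ ∷ D-unique) {suc i} {suc j} eq = cong suc (lookup-injective D D-unique eq)

  -- An enumeration of all finite lists of pairs of naturals.  `unpair` walks through ℕ × ℕ
  -- along the anti-diagonals a + b = s.
  next : ℕ × ℕ → ℕ × ℕ
  next (a , zero) = (0 , suc a)
  next (a , suc b) = (suc a , b)

  unpair : ℕ → ℕ × ℕ
  unpair zero = (0 , 0)
  unpair (suc n) = next (unpair n)

  unpair-diagonal : ∀ s a b → a + b ≡ s → ∃ λ n → unpair n ≡ (a , b)
  unpair-diagonal zero zero zero _ = 0 , refl
  unpair-diagonal s (suc a) b eq with unpair-diagonal s a (suc b) (trans (+-suc a b) eq)
  ... | n , eqn = suc n , cong next eqn
  unpair-diagonal (suc s) zero (suc b) eq with unpair-diagonal s b zero (trans (+-identityʳ b) (suc-injective eq))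
  ... | n , eqn = suc n , cong next eqn

  unpair-surjective : ∀ a b → ∃ λ n → unpair n ≡ (a , b)
  unpair-surjective a b = unpair-diagonal (a + b) a b refl

  decodeOfLength : ℕ → ℕ → List (ℕ × ℕ)
  decodeOfLength zero c = []
  decodeOfLength (suc l) c = unpair (proj₁ (unpair c)) ∷ decodeOfLength l (proj₂ (unpair c))

  decode : ℕ → List (ℕ × ℕ)
  decode n = decodeOfLength (proj₁ (unpair n)) (proj₂ (unpair n))

  decodeOfLength-surjective : ∀ q → ∃ λ c → decodeOfLength (length q) c ≡ q
  decodeOfLength-surjective [] = 0 , refl
  decodeOfLength-surjective ((a , b) ∷ q) with decodeOfLength-surjective q | unpair-surjective a b
  ... | c′ , eq′ | x , eqx with unpair-surjective x c′
  ... | c , eqc = c , trans (cong (λ p → unpair (proj₁ p) ∷ decodeOfLength (length q) (proj₂ p)) eqc) (cong₂ _∷_ eqx eq′)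

  decode-surjective : ∀ q → ∃ λ n → decode n ≡ q
  decode-surjective q with decodeOfLength-surjective q
  ... | c , eqc with unpair-surjective (length q) c
  ... | n , eqn = n , trans (cong (λ p → decodeOfLength (proj₁ p) (proj₂ p)) eqn) eqc

  module _ (U : CountableDiv) where

    private
      module UD = IsRationalDiversity (isDiv U)

    idAut : Aut U
    idAut = record { to = id ; from = id ; to-from = λ _ → refl ; from-to = λ _ → refl
                   ; pres = λ L → cong (Δ U) (map-id L) }

    inverseAut : Aut U → Aut U
    inverseAut σ = record
      { to = from σ ; from = to σ ; to-from = from-to σ ; from-to = to-from σ
      ; pres = λ L → trans (sym (pres σ (map (from σ) L)))
                           (cong (Δ U) (trans (sym (map-∘ L)) (trans (map-cong (to-from σ) L) (map-id L))))
      }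

    composeAut : Aut U → Aut U → Aut U
    composeAut σ τ = record
      { to = to σ ∘ to τ ; from = from τ ∘ from σ
      ; to-from = λ x → trans (cong (to σ) (to-from τ (from σ x))) (to-from σ x)
      ; from-to = λ x → trans (cong (from τ) (from-to σ (to τ x))) (from-to τ x)
      ; pres = λ L → trans (cong (Δ U) (map-∘ L)) (trans (pres σ (map (to τ) L)) (pres τ L))
      }

    to-injective : (σ : Aut U) {x y : ℕ} → to σ x ≡ to σ y → x ≡ y
    to-injective σ {x} {y} eq = trans (sym (from-to σ x)) (trans (cong (from σ) eq) (from-to σ y))

    from-≡ : (σ : Aut U) {x y : ℕ} → to σ x ≡ y → from σ y ≡ x
    from-≡ σ {x} refl = from-to σ x

    extendIndexed : Ultrahomogeneous U → {T : Set} (I : List T) (c d : T → ℕ) →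
      (∀ {i j} → i ∈ I → j ∈ I → c i ≡ c j → i ≡ j) →
      (∀ {i j} → i ∈ I → j ∈ I → d i ≡ d j → i ≡ j) →
      (∀ L → L ⊆ˡ I → Δ U (map c L) ≡ Δ U (map d L)) →
      Σ (Aut U) λ σ → ∀ {i} → i ∈ I → to σ (c i) ≡ d i
    extendIndexed UH {T} I c d c-inj d-inj c≈d with UH (map c I) φ φ-injective φ-preserves
      where
      φ : ℕ → ℕ
      φ = applyPairs (graphOn c d I)
      φ-injective : ∀ {x y} → x ∈ map c I → y ∈ map c I → φ x ≡ φ y → x ≡ y
      φ-injective x∈ y∈ eq with applyPairs-graphOn c d I x∈ | applyPairs-graphOn c d I y∈
      ... | i , i∈ , refl , φx≡di | j , j∈ , refl , φy≡dj = cong c (d-inj i∈ j∈ (trans (sym φx≡di) (trans eq φy≡dj)))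
      sublist-preimage : (L : List ℕ) → L ⊆ˡ map c I →
        Σ (List T) λ L′ → L′ ⊆ˡ I × map c L′ ≡ L × map d L′ ≡ map φ L
      sublist-preimage [] _ = [] , (λ ()) , refl , refl
      sublist-preimage (x ∷ L) L⊆ with applyPairs-graphOn c d I (L⊆ (here refl)) | sublist-preimage L (L⊆ ∘ there)
      ... | j , j∈ , cj≡x , φx≡dj | L′ , L′⊆ , cL′≡L , dL′≡φL =
        j ∷ L′ , (λ { (here refl) → j∈ ; (there m) → L′⊆ m }) , cong₂ _∷_ cj≡x cL′≡L , cong₂ _∷_ (sym φx≡dj) dL′≡φL
      φ-preserves : ∀ L → L ⊆ˡ map c I → Δ U (map φ L) ≡ Δ U L
      φ-preserves L L⊆ with sublist-preimage L L⊆
      ... | L′ , L′⊆ , cL′≡L , dL′≡φL = trans (cong (Δ U) (sym dL′≡φL)) (trans (sym (c≈d L′ L′⊆)) (cong (Δ U) cL′≡L))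
    ... | σ , σ≡φ = σ , λ {i} i∈ → σ-on i i∈
      where
      σ-on : ∀ i → i ∈ I → to σ (c i) ≡ d i
      σ-on i i∈ with applyPairs-graphOn c d I (∈-map⁺ c i∈)
      ... | j , j∈ , cj≡ci , φ≡dj = trans (σ≡φ (∈-map⁺ c i∈)) (trans φ≡dj (cong d (c-inj j∈ i∈ cj≡ci)))

    subDiv : (D : List ℕ) → Unique D → FinDiv
    subDiv D D-unique = record { size = length D ; δ = λ L → Δ U (map (lookup D) L)
                               ; isDiv = pullbackDiversity (lookup D) (lookup-injective D D-unique) (isDiv U) }

    -- The 𝒟-system traced by an automorphism σ on a finite set F: the subdiversity on F ∪ σ(F)
    -- with partial automorphism σ restricted to F.
    module Trace (σ : Aut U) (F : List ℕ) where
      private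
        D : List ℕ
        D = deduplicate _≟_ (F ++ map (to σ) F)
        D-unique : Unique D
        D-unique = deduplicate-! (F ++ map (to σ) F)
        ∈D : ∀ {x} → x ∈ F ++ map (to σ) F → x ∈ D
        ∈D = ∈-deduplicate⁺ _≟_

      e : Fin (length D) → ℕ
      e = lookup D

      e-injective : Injective e
      e-injective = lookup-injective D D-unique

      position : ∀ {x} → x ∈ F ++ map (to σ) F → Fin (length D)
      position x∈ = index (∈D x∈)

      e-position : ∀ {x} (x∈ : x ∈ F ++ map (to σ) F) → e (position x∈) ≡ x
      e-position x∈ = sym (lookup-index (∈D x∈))

      private
        traceAt : (i : Fin (length D)) → Dec (e i ∈ F) → Maybe (Fin (length D))
        traceAt i (yes e[i]∈F) = just (position (∈-++⁺ʳ F (∈-map⁺ (to σ) e[i]∈F)))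
        traceAt i (no _) = nothing

        traceAt-step : ∀ i (d : Dec (e i ∈ F)) {j} → traceAt i d ≡ just j → e j ≡ to σ (e i)
        traceAt-step i (yes _) refl = e-position _

        traceAt-defined : ∀ i (d : Dec (e i ∈ F)) → e i ∈ F → ∃ λ j → traceAt i d ≡ just j
        traceAt-defined i (yes _) _ = _ , refl
        traceAt-defined i (no e[i]∉F) e[i]∈F = ⊥-elim (e[i]∉F e[i]∈F)

      tracePart : Fin (length D) → Maybe (Fin (length D))
      tracePart i = traceAt i (e i ∈? F)

      tracePart-step : ∀ {i j} → tracePart i ≡ just j → e j ≡ to σ (e i)
      tracePart-step {i} = traceAt-step i (e i ∈? F)

      tracePart-defined : ∀ {i} → e i ∈ F → ∃ λ j → tracePart i ≡ just j
      tracePart-defined {i} = traceAt-defined i (e i ∈? F)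

      private
        tracePart-injective : ∀ {i i′ j} → tracePart i ≡ just j → tracePart i′ ≡ just j → i ≡ i′
        tracePart-injective p q = e-injective (to-injective σ (trans (sym (tracePart-step p)) (tracePart-step q)))

        maps-σ : ∀ {L M} → MapsTo tracePart L M → map e M ≡ map (to σ) (map e L)
        maps-σ [] = refl
        maps-σ (p ∷ ps) = cong₂ _∷_ (tracePart-step p) (maps-σ ps)

      system : 𝒟System
      system = record
        { div = subDiv D D-unique ; part = tracePart ; part-inj = tracePart-injective
        ; part-pres = λ L M ps → trans (cong (Δ U) (maps-σ ps)) (pres σ (map e L)) }

    record EmbedsInU (A : FinDiv) (e : Fin (size A) → ℕ) : Set where
      constructor embeds
      field
        injective : Injective e
        preserves : ∀ L → Δ U (map e L) ≡ δ A L

    embeds-∘ : ∀ {S W e} (E : SysEmbedding S W) → EmbedsInU (div W) e → EmbedsInU (div S) (e ∘ SysEmbedding.Φ E)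
    embeds-∘ E (embeds e-inj e-pres) with SysEmbedding.isEmb E
    ... | Φ-inj , Φ-pres = embeds (Φ-inj ∘ e-inj) λ L →
      trans (cong (Δ U) (map-∘ L)) (trans (e-pres (map (SysEmbedding.Φ E) L)) (Φ-pres L))

    embeds-Aut : ∀ {A e} (τ : Aut U) → EmbedsInU A e → EmbedsInU A (to τ ∘ e)
    embeds-Aut {e = e} τ (embeds e-inj e-pres) =
      embeds (e-inj ∘ to-injective τ) λ L → trans (cong (Δ U) (map-∘ L)) (trans (pres τ (map e L)) (e-pres L))

    embeds-trace : ∀ σ F → EmbedsInU (div (Trace.system σ F)) (Trace.e σ F)
    embeds-trace σ F = embeds (Trace.e-injective σ F) λ L → refl

    embeddings-conjugate : Ultrahomogeneous U → ∀ {A e₁ e₂} → EmbedsInU A e₁ → EmbedsInU A e₂ →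
      Σ (Aut U) λ τ → ∀ i → to τ (e₁ i) ≡ e₂ i
    embeddings-conjugate UH {A} {e₁} {e₂} (embeds e₁-inj e₁-pres) (embeds e₂-inj e₂-pres)
      with extendIndexed UH (allFin (size A)) e₁ e₂ (λ _ _ → e₁-inj) (λ _ _ → e₂-inj)
                         (λ L _ → trans (e₁-pres L) (sym (e₂-pres L)))
    ... | τ , τ-maps = τ , λ i → τ-maps (∈-allFin i)

    private
      module SystemImage (W : 𝒟System) (e : Fin (size (div W)) → ℕ) where
        isDefined : (m : Maybe (Fin (size (div W)))) → Dec (∃ λ b → m ≡ just b)
        isDefined (just b) = yes (b , refl)
        isDefined nothing = no λ ()

        domain : List (Fin (size (div W)))
        domain = filter (isDefined ∘ part W) (allFin _)

        domain⁺ : ∀ {a b} → part W a ≡ just b → a ∈ domain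
        domain⁺ {a} pa = ∈-filter⁺ (isDefined ∘ part W) (∈-allFin a) (_ , pa)

        domain⁻ : ∀ {a} → a ∈ domain → ∃ λ b → part W a ≡ just b
        domain⁻ a∈ = proj₂ (∈-filter⁻ (isDefined ∘ part W) {xs = allFin _} a∈)

        valueIn : Maybe (Fin (size (div W))) → ℕ
        valueIn (just b) = e b
        valueIn nothing = 0

        image : Fin (size (div W)) → ℕ
        image a = valueIn (part W a)

        image-≡ : ∀ {a b} → part W a ≡ just b → image a ≡ e b
        image-≡ eq rewrite eq = refl

        image-list : ∀ L → L ⊆ˡ domain → Σ (List (Fin (size (div W)))) λ M → MapsTo (part W) L M × map image L ≡ map e M
        image-list [] _ = [] , [] , refl
        image-list (a ∷ L) L⊆ with domain⁻ (L⊆ (here refl)) | image-list L (L⊆ ∘ there)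
        ... | b , pa | M , ps , eq = b ∷ M , pa ∷ ps , cong₂ _∷_ (image-≡ pa) eq

    realizeSystem : Ultrahomogeneous U → (W : 𝒟System) (e : Fin (size (div W)) → ℕ) → EmbedsInU (div W) e →
      Σ (Aut U) λ σ → ∀ {a b} → part W a ≡ just b → to σ (e a) ≡ e b
    realizeSystem UH W e (embeds e-inj e-pres) with extendIndexed UH domain e image (λ _ _ → e-inj) image-injective preserves
      where
      open SystemImage W e
      image-injective : ∀ {a a′} → a ∈ domain → a′ ∈ domain → image a ≡ image a′ → a ≡ a′
      image-injective a∈ a′∈ eq with domain⁻ a∈ | domain⁻ a′∈
      ... | b , pa | b′ , pa′ with e-inj (trans (sym (image-≡ pa)) (trans eq (image-≡ pa′)))
      ... | refl = part-inj W pa pa′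
      preserves : ∀ L → L ⊆ˡ domain → Δ U (map e L) ≡ Δ U (map image L)
      preserves L L⊆ with image-list L L⊆
      ... | M , ps , eq = trans (e-pres L) (trans (sym (part-pres W L M ps)) (trans (sym (e-pres M)) (cong (Δ U) (sym eq))))
    ... | σ , σ-maps = σ , λ pa → trans (σ-maps (SystemImage.domain⁺ W e pa)) (SystemImage.image-≡ W e pa)

    conjugate-agrees : (σ : Aut U) (F : List ℕ) (W : 𝒟System) (E : SysEmbedding (Trace.system σ F) W)
      (e : Fin (size (div W)) → ℕ) (σ″ : Aut U) → (∀ {a b} → part W a ≡ just b → to σ″ (e a) ≡ e b) →
      (λ′ : Aut U) → (∀ i → to λ′ (e (SysEmbedding.Φ E i)) ≡ Trace.e σ F i) →
      ∀ {x} → x ∈ F → to λ′ (to σ″ (from λ′ x)) ≡ to σ x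
    conjugate-agrees σ F W E e σ″ σ″-realizes λ′ λ′-moves {x} x∈F = begin
      to λ′ (to σ″ (from λ′ x))          ≡⟨ cong (to λ′ ∘ to σ″) (from-≡ λ′ (trans (λ′-moves i) eᵢ≡x)) ⟩
      to λ′ (to σ″ (e (E.Φ i)))          ≡⟨ cong (to λ′) (σ″-realizes (E.commute i↦j)) ⟩
      to λ′ (e (E.Φ j))                  ≡⟨ λ′-moves j ⟩
      T.e j                              ≡⟨ T.tracePart-step i↦j ⟩
      to σ (T.e i)                       ≡⟨ cong (to σ) eᵢ≡x ⟩
      to σ x                             ∎
      where
      open ≡-Reasoning
      module T = Trace σ F
      module E = SysEmbedding E
      i j : Fin (size (div T.system))
      i = T.position (∈-++⁺ˡ x∈F)
      eᵢ≡x : T.e i ≡ x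
      eᵢ≡x = T.e-position (∈-++⁺ˡ x∈F)
      j = proj₁ (T.tracePart-defined (subst (_∈ F) (sym eᵢ≡x) x∈F))
      i↦j : T.tracePart i ≡ just j
      i↦j = proj₂ (T.tracePart-defined (subst (_∈ F) (sym eᵢ≡x) x∈F))

    -- The traces of σ on F and of ρ on
    -- F′ are jointly embedded into a system W; W is copied into U and realized by an automorphism
    -- σ″, and conjugating σ″ back onto the two traces gives σ′ and k.
    record Amalgam (σ : Aut U) (F : List ℕ) (ρ : Aut U) (F′ : List ℕ) : Set where
      field
        σ′ : Aut U
        k  : Aut U
        σ′-extends    : ∀ {x} → x ∈ F → to σ′ x ≡ to σ x
        σ′-conjugates : ∀ {x} → x ∈ F′ → to σ′ (from k x) ≡ from k (to ρ x)

    amalgamate : JointEmbeddingProperty → IsRationalUrysohn U → ∀ σ F ρ F′ → Amalgam σ F ρ F′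
    amalgamate jep (UH , age) σ F ρ F′ = record
      { σ′ = composeAut τ (composeAut σ″ (inverseAut τ))
      ; k = k
      ; σ′-extends = conjugate-agrees σ F W E₁ e σ″ σ″-realizes τ τ-moves
      ; σ′-conjugates = λ {x} x∈F′ → sym (from-≡ k
          (conjugate-agrees ρ F′ W E₂ e σ″ σ″-realizes (composeAut k τ) k-moves x∈F′))
      }
      where
      W : 𝒟System
      W = proj₁ (jep (Trace.system σ F) (Trace.system ρ F′))
      E₁ : SysEmbedding (Trace.system σ F) W
      E₁ = proj₁ (proj₂ (jep (Trace.system σ F) (Trace.system ρ F′)))
      E₂ : SysEmbedding (Trace.system ρ F′) W
      E₂ = proj₂ (proj₂ (jep (Trace.system σ F) (Trace.system ρ F′)))
      e : Fin (size (div W)) → ℕ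
      e = proj₁ (age (div W))
      e-embeds : EmbedsInU (div W) e
      e-embeds = embeds (proj₁ (proj₂ (age (div W)))) (proj₂ (proj₂ (age (div W))))
      σ″ : Aut U
      σ″ = proj₁ (realizeSystem UH W e e-embeds)
      σ″-realizes : ∀ {a b} → part W a ≡ just b → to σ″ (e a) ≡ e b
      σ″-realizes = proj₂ (realizeSystem UH W e e-embeds)
      -- τ moves the copy of the trace of σ inside e(W) back onto F ∪ σ(F)
      τ : Aut U
      τ = proj₁ (embeddings-conjugate UH (embeds-∘ E₁ e-embeds) (embeds-trace σ F))
      τ-moves : ∀ i → to τ (e (SysEmbedding.Φ E₁ i)) ≡ Trace.e σ F i
      τ-moves = proj₂ (embeddings-conjugate UH (embeds-∘ E₁ e-embeds) (embeds-trace σ F))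
      -- k then moves the (τ-moved) copy of the trace of ρ back onto F′ ∪ ρ(F′)
      k : Aut U
      k = proj₁ (embeddings-conjugate UH (embeds-Aut τ (embeds-∘ E₂ e-embeds)) (embeds-trace ρ F′))
      k-moves : ∀ i → to k (to τ (e (SysEmbedding.Φ E₂ i))) ≡ Trace.e ρ F′ i
      k-moves = proj₂ (embeddings-conjugate UH (embeds-Aut τ (embeds-∘ E₂ e-embeds)) (embeds-trace ρ F′))

    IsPartialIso : List ℕ → (ℕ → ℕ) → Set
    IsPartialIso F φ = (∀ {x y} → x ∈ F → y ∈ F → φ x ≡ φ y → x ≡ y) × (∀ L → L ⊆ˡ F → Δ U (map φ L) ≡ Δ U L)

    -- Being a partial isomorphism is decidable, since it suffices to test preservation on the
    -- finitely many sublists of F (every L ⊆ F has the same points as such a sublist).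
    isPartialIso? : ∀ F φ → Dec (IsPartialIso F φ)
    isPartialIso? F φ with injective? | preserving?
      where
      injective? : Dec (All (λ x → All (λ y → φ x ≡ φ y → x ≡ y) F) F)
      injective? = all? (λ x → all? (λ y → (φ x ≟ φ y) →-dec (x ≟ y)) F) F
      preserving? : Dec (All (λ L → Δ U (map φ L) ≡ Δ U L) (sublists F))
      preserving? = all? (λ L → Δ U (map φ L) ℚ.≟ Δ U L) (sublists F)
    ... | no ¬inj | _ = no λ iso → ¬inj (All.tabulate λ x∈ → All.tabulate λ y∈ → proj₁ iso x∈ y∈)
    ... | yes _ | no ¬pres = no λ iso → ¬pres (All.tabulate λ {S} S∈ → proj₂ iso S (sublists-⊆ F S∈))
    ... | yes inj | yes pres = yes ((λ x∈ y∈ → All.lookup (All.lookup inj x∈) y∈) , preserves)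
      where
      preserves : ∀ L → L ⊆ˡ F → Δ U (map φ L) ≡ Δ U L
      preserves L L⊆F = trans (UD.respects _ _ (map-⊆ φ (⊆-restrict L⊆F)) (map-⊆ φ (restrict-⊆ L F)))
                          (trans (All.lookup pres (restrict∈sublists L F)) (UD.respects _ _ (restrict-⊆ L F) (⊆-restrict L⊆F)))

    graph-isPartialIso : (g : Aut U) (F : List ℕ) →
      IsPartialIso (map proj₁ (graphOn id (to g) F)) (applyPairs (graphOn id (to g) F))
    graph-isPartialIso g F = subst (λ F′ → IsPartialIso F′ (applyPairs (graphOn id (to g) F))) (sym (graphOn-domain (to g) F))
      ( (λ x∈ y∈ eq → to-injective g (trans (sym (applyPairs-graph (to g) F x∈)) (trans eq (applyPairs-graph (to g) F y∈))))
      , λ L L⊆F → trans (cong (Δ U) (map-cong-local (All.tabulate λ x∈ → applyPairs-graph (to g) F (L⊆F x∈)))) (pres g L))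

    -- At stage n the requirement q = decode n is attended to: if q is a partial
    -- isomorphism, the approximation is amalgamated with an automorphism extending q, so that some
    -- conjugate of the limit will agree with q.  Each stage also settles n and its preimage, so
    -- that the limit is a bijection.
    module GenericAutomorphism (jep : JointEmbeddingProperty) (urysohn : IsRationalUrysohn U) where

      -- An approximation σ whose values on `settled` are final.
      record Stage : Set where
        constructor stage
        field
          current : Aut U
          settled : List ℕ
      open Stage

      PartialIso : List (ℕ × ℕ) → Set
      PartialIso q = IsPartialIso (map proj₁ q) (applyPairs q)

      extension : (q : List (ℕ × ℕ)) → PartialIso q → Aut U
      extension q (inj , pres) = proj₁ (proj₁ urysohn (map proj₁ q) (applyPairs q) inj pres)

      extension-extends : (q : List (ℕ × ℕ)) (iso : PartialIso q) → ∀ {x} → x ∈ map proj₁ q → to (extension q iso) x ≡ applyPairs q x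
      extension-extends q (inj , pres) = proj₂ (proj₁ urysohn (map proj₁ q) (applyPairs q) inj pres)

      amalgamWith : (s : Stage) (q : List (ℕ × ℕ)) (iso : PartialIso q) →
        Amalgam (current s) (settled s) (extension q iso) (map proj₁ q)
      amalgamWith s q iso = amalgamate jep urysohn (current s) (settled s) (extension q iso) (map proj₁ q)

      attendWith : Stage → (q : List (ℕ × ℕ)) → Dec (PartialIso q) → Stage
      attendWith s q (yes iso) = stage (Amalgam.σ′ A) (settled s ++ map (from (Amalgam.k A)) (map proj₁ q))
        where A = amalgamWith s q iso
      attendWith s q (no _) = s

      attend : Stage → List (ℕ × ℕ) → Stage
      attend s q = attendWith s q (isPartialIso? (map proj₁ q) (applyPairs q))

      attend-persists : ∀ s q {x} → x ∈ settled s → x ∈ settled (attend s q) × to (current (attend s q)) x ≡ to (current s) x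
      attend-persists s q x∈ with isPartialIso? (map proj₁ q) (applyPairs q)
      ... | yes iso = ∈-++⁺ˡ x∈ , Amalgam.σ′-extends (amalgamWith s q iso) x∈
      ... | no _ = x∈ , refl

      attend-meets : ∀ s q → PartialIso q → Σ (Aut U) λ k → ∀ {x} → x ∈ map proj₁ q →
        from k x ∈ settled (attend s q) × to (current (attend s q)) (from k x) ≡ from k (applyPairs q x)
      attend-meets s q iso₀ with isPartialIso? (map proj₁ q) (applyPairs q)
      ... | no ¬iso = ⊥-elim (¬iso iso₀)
      ... | yes iso = k , λ x∈ → ∈-++⁺ʳ (settled s) (∈-map⁺ (from k) x∈) ,
                                  trans (Amalgam.σ′-conjugates A x∈) (cong (from k) (extension-extends q iso x∈))
        where
        A : Amalgam (current s) (settled s) (extension q iso) (map proj₁ q)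
        A = amalgamWith s q iso
        k : Aut U
        k = Amalgam.k A

      step : ℕ → Stage → Stage
      step n s = stage (current s′) (n ∷ from (current s′) n ∷ settled s′)
        where s′ = attend s (decode n)

      stages : ℕ → Stage
      stages zero = stage idAut []
      stages (suc n) = step n (stages n)

      SettledSince : ℕ → ℕ → ℕ → Set
      SettledSince n t x = x ∈ settled (stages t) × to (current (stages t)) x ≡ to (current (stages n)) x

      persists-for : ∀ d n {x} → x ∈ settled (stages n) → SettledSince n (d + n) x
      persists-for zero n x∈ = x∈ , refl
      persists-for (suc d) n x∈ with persists-for d n x∈
      ... | x∈′ , eq′ with attend-persists (stages (d + n)) (decode (d + n)) x∈′
      ... | x∈″ , eq″ = there (there x∈″) , trans eq″ eq′

      persists : ∀ {n t x} → n ≤ t → x ∈ settled (stages n) → SettledSince n t x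
      persists {n} {t} n≤t x∈ = subst (λ t → SettledSince n t _) (m∸n+n≡m n≤t) (persists-for (t ∸ n) n x∈)

      -- The limit automorphism: x is settled from stage suc x on.
      limit-to : ℕ → ℕ
      limit-to x = to (current (stages (suc x))) x

      limit-from : ℕ → ℕ
      limit-from y = from (current (stages (suc y))) y

      limit-agrees : ∀ {n x} → x ∈ settled (stages n) → limit-to x ≡ to (current (stages n)) x
      limit-agrees {n} {x} x∈ = trans (sym (proj₂ (persists (m≤n+m (suc x) n) (here refl))))
                                      (proj₂ (persists (m≤m+n n (suc x)) x∈))

      limit-to-from : ∀ y → limit-to (limit-from y) ≡ y
      limit-to-from y = trans (limit-agrees {suc y} (there (here refl))) (to-from (current (stages (suc y))) y)

      limit-from-to : ∀ x → limit-from (limit-to x) ≡ x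
      limit-from-to x = to-injective (current (stages t)) (trans y′↦y (sym x↦y))
        where
        y t : ℕ
        y = limit-to x
        t = suc y + suc x
        y′↦y : to (current (stages t)) (limit-from y) ≡ y
        y′↦y = trans (proj₂ (persists (m≤m+n (suc y) (suc x)) (there (here refl)))) (to-from (current (stages (suc y))) y)
        x↦y : to (current (stages t)) x ≡ y
        x↦y = proj₂ (persists (m≤n+m (suc x) (suc y)) (here refl))

      bound : List ℕ → ℕ
      bound [] = 0
      bound (x ∷ L) = suc x + bound L

      bound-≤ : ∀ L {x} → x ∈ L → suc x ≤ bound L
      bound-≤ (x ∷ L) (here refl) = m≤m+n (suc x) (bound L)
      bound-≤ (y ∷ L) (there x∈) = ≤-trans (bound-≤ L x∈) (m≤n+m (bound L) (suc y))

      limit-preserves : ∀ L → Δ U (map limit-to L) ≡ Δ U L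
      limit-preserves L = trans (cong (Δ U) (map-cong-local (All.tabulate λ x∈ → limit-agrees {bound L} (settled-by-bound x∈))))
                                (pres (current (stages (bound L))) L)
        where
        settled-by-bound : ∀ {x} → x ∈ L → x ∈ settled (stages (bound L))
        settled-by-bound x∈ = proj₁ (persists (bound-≤ L x∈) (here refl))

      generic : Aut U
      generic = record { to = limit-to ; from = limit-from ; to-from = limit-to-from
                       ; from-to = limit-from-to ; pres = limit-preserves }

      -- Every partial isomorphism q is decoded at some stage N; there a conjugate of the
      -- approximation agrees with q on settled points, hence so does the same conjugate of the limit.
      conjugate-meets : ∀ q → PartialIso q →
        Σ (Aut U) λ k → ∀ {x} → x ∈ map proj₁ q → conjFun k generic x ≡ applyPairs q x
      conjugate-meets q iso with decode-surjective q
      ... | N , refl = k , λ x∈ → agrees (proj₂ met x∈)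
        where
        s′ : Stage
        s′ = attend (stages N) (decode N)
        met : Σ (Aut U) λ k → ∀ {x} → x ∈ map proj₁ (decode N) →
          from k x ∈ settled s′ × to (current s′) (from k x) ≡ from k (applyPairs (decode N) x)
        met = attend-meets (stages N) (decode N) iso
        k : Aut U
        k = proj₁ met
        agrees : ∀ {x} → from k x ∈ settled s′ × to (current s′) (from k x) ≡ from k (applyPairs (decode N) x) →
          conjFun k generic x ≡ applyPairs (decode N) x
        agrees {x} (settled-N , conjugates) = begin
          to k (limit-to (from k x))               ≡⟨ cong (to k) (limit-agrees {suc N} (there (there settled-N))) ⟩
          to k (to (current s′) (from k x))        ≡⟨ cong (to k) conjugates ⟩
          to k (from k (applyPairs (decode N) x))  ≡⟨ to-from k _ ⟩
          applyPairs (decode N) x                  ∎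
          where open ≡-Reasoning

      generic-dense : ∀ (g : Aut U) (F : List ℕ) → Σ (Aut U) λ k → ∀ {x} → x ∈ F → conjFun k generic x ≡ to g x
      generic-dense g F with conjugate-meets (graphOn id (to g) F) (graph-isPartialIso g F)
      ... | k , k-meets = k , λ x∈ →
        trans (k-meets (subst (_ ∈_) (sym (graphOn-domain (to g) F)) x∈)) (applyPairs-graph (to g) F x∈)

    denseConjugacyClass : JointEmbeddingProperty → IsRationalUrysohn U → HasDenseConjugacyClass U
    denseConjugacyClass jep urysohn = generic , generic-dense
      where open GenericAutomorphism jep urysohn

mainTheorem5 : JointEmbeddingProperty × (∀ (U : CountableDiv) → IsRationalUrysohn U → HasDenseConjugacyClass U)
mainTheorem5 = JointEmbedding.jointEmbedding , λ U → DenseConjugacy.denseConjugacyClass U JointEmbedding.jointEmbedding
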